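{- Let $p$ be a prime and $D\subset\mathbb{N}\setminus\{0\}$ a finite nonempty set with $D\neq\{1\}$ and containing no multiple of $p$. Then $$\frac{1}{\sigma_p(D)}\le\pi_p(D)\le\frac12.$$
   Context: $\sigma_p(N)$ is the sum of base-$p$ digits of $N\ge0$, and $\sigma_p(D)=\max_{d\in D}\sigma_p(d)$. Writing $D=\{d_1,\dots,d_n\}$, for $m\ge1$ let $E_D(m)$ be the set of $(u_1,\dots,u_n)\in\{0,\dots,p^m-1\}^n\setminus\{0\}$ with $\sum_iu_id_i\equiv0\pmod{p^m-1}$ and $\sum_iu_id_i>0$; $\sigma_p(D,m)=\min_{U\in E_D(m)}\sum_i\sigma_p(u_i)$, and $\pi_p(D)=\frac{1}{p-1}\min_{m\ge1}\frac{\sigma_p(D,m)}{m}$. -}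

module Defs where

open import Data.Nat using (ℕ; zero; suc; _+_; _*_; _⊔_)
open import Data.Nat.DivMod using (_/_; _%_)
open import Data.Fin using (Fin; zero; suc)
import Data.Nat.Divisibility

-- Base-p digit sum, with fuel k (k = N suffices for p ≥ 2).
digitSumAux : ℕ → ℕ → ℕ → ℕ
digitSumAux zero    p       N = 0
digitSumAux (suc k) zero    N = 0
digitSumAux (suc k) (suc q) N = N % suc q + digitSumAux k (suc q) (N / suc q)

-- σ_p(N): sum of the base-p digits of N (meaningful for p ≥ 2).
σ : ℕ → ℕ → ℕ
σ p N = digitSumAux N p N

Σᶠ : (n : ℕ) → (Fin n → ℕ) → ℕ
Σᶠ zero    f = 0
Σᶠ (suc n) f = f zero + Σᶠ n (λ i → f (suc i))

maxᶠ : (n : ℕ) → (Fin n → ℕ) → ℕ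
maxᶠ zero    f = 0
maxᶠ (suc n) f = f zero ⊔ maxᶠ n (λ i → f (suc i))

-- σ_p(D) for D = {d_0,…,d_{n-1}}: max of digit sums.
σD : ℕ → (n : ℕ) → (Fin n → ℕ) → ℕ
σD p n d = maxᶠ n (λ i → σ p (d i))

record InE (p : ℕ) (n : ℕ) (d : Fin n → ℕ) (m : ℕ) (u : Fin n → ℕ) : Set where
  field
    bounded  : ∀ i → u i Data.Nat.< p Data.Nat.^ m
    divisible : (p Data.Nat.^ m Data.Nat.∸ 1) Data.Nat.Divisibility.∣ Σᶠ n (λ i → u i * d i)
    positive : 0 Data.Nat.< Σᶠ n (λ i → u i * d i)

weight : ℕ → (n : ℕ) → (Fin n → ℕ) → ℕ
weight p n u = Σᶠ n (λ i → σ p (u i))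

-- The base-p digit sum σ is subadditive and submultiplicative,
-- so σ(Σ uᵢdᵢ) ≤ σ(D) · Σ σ(uᵢ). On the other hand every positive multiple S
-- of p^m − 1 has σ(S) ≥ (p−1)m: folding S into (S mod p^m) + (S div p^m)
-- keeps the multiple positive and divisible by p^m − 1, does not increase σ,
-- and strictly decreases S until S = p^m − 1, whose digit sum is (p−1)m.
--
-- Pick δ ∈ D with δ ≥ 2 and let m be such that δ ∣ p^m − 1
-- (a multiplicative order, found by pigeonhole). Then c = (p^m − 1)/δ and
-- its complement c' = p^m − 1 − c satisfy σ(c) + σ(c') = (p−1)m, since the
-- base-p digits of c and c' add up to p − 1 position by position. Both c·δ
-- and c'·δ are positive multiples of p^m − 1, so the vector carrying the one
-- of c, c' with the smaller digit sum at the position of δ is the witness.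
--
-- The statement clears denominators: (p−1)m ≤ σ(D) · Σ σ(uᵢ) for all
-- U ∈ E_D(m), and some U ∈ E_D(m) has 2 Σ σ(uᵢ) ≤ (p−1)m.
module Submission where

open import Defs
open import Data.Nat using (ℕ; zero; suc; _+_; _*_; _^_; _∸_; _≤_; _<_; z≤n; s≤s; NonZero; >-nonZero)
open import Data.Nat.Properties
open import Data.Nat.DivMod
open import Data.Nat.Divisibility using (_∣_; divides; ∣m+n∣m⇒∣n)
open import Data.Nat.Coprimality using (Coprime; coprime-divisor)
open import Data.Nat.Primality using (Prime; prime⇒irreducible)
open import Data.Nat.Tactic.RingSolver using (solve-∀)
open import Data.Fin as Fin using (Fin; zero; suc; toℕ)
import Data.Fin.Properties as Finₚ
open import Data.Product using (Σ; _×_; _,_)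
open import Data.Sum using (inj₁; inj₂)
open import Data.Empty using (⊥-elim)
open import Function using (_∘_)
open import Function.Definitions using (Injective)
open import Relation.Binary.PropositionalEquality
open import Relation.Nullary using (¬_; Dec; yes; no)

open ≤-Reasoning

Σᶠ-mono : ∀ n {f g : Fin n → ℕ} → (∀ i → f i ≤ g i) → Σᶠ n f ≤ Σᶠ n g
Σᶠ-mono zero    f≤g = z≤n
Σᶠ-mono (suc n) f≤g = +-mono-≤ (f≤g zero) (Σᶠ-mono n (f≤g ∘ suc))

Σᶠ-*ʳ : ∀ n (f : Fin n → ℕ) c → Σᶠ n (λ i → f i * c) ≡ Σᶠ n f * c
Σᶠ-*ʳ zero    f c = refl
Σᶠ-*ʳ (suc n) f c = trans (cong (f zero * c +_) (Σᶠ-*ʳ n (f ∘ suc) c))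
                          (sym (*-distribʳ-+ c (f zero) (Σᶠ n (f ∘ suc))))

Σᶠ-zero : ∀ n (f : Fin n → ℕ) → (∀ i → f i ≡ 0) → Σᶠ n f ≡ 0
Σᶠ-zero zero    f f≡0 = refl
Σᶠ-zero (suc n) f f≡0 = cong₂ _+_ (f≡0 zero) (Σᶠ-zero n (f ∘ suc) (f≡0 ∘ suc))

Σᶠ-concentrated : ∀ n (i₀ : Fin n) (f : Fin n → ℕ) → (∀ i → i ≢ i₀ → f i ≡ 0) → Σᶠ n f ≡ f i₀
Σᶠ-concentrated (suc n) zero f off =
  trans (cong (f zero +_) (Σᶠ-zero n (f ∘ suc) (λ i → off (suc i) λ ()))) (+-identityʳ (f zero))
Σᶠ-concentrated (suc n) (suc i₀) f off =
  cong₂ _+_ (off zero λ ()) (Σᶠ-concentrated n i₀ (f ∘ suc) (λ i i≢i₀ → off (suc i) (i≢i₀ ∘ Finₚ.suc-injective)))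

maxᶠ-upper : ∀ n (f : Fin n → ℕ) i → f i ≤ maxᶠ n f
maxᶠ-upper (suc n) f zero    = m≤m⊔n (f zero) (maxᶠ n (f ∘ suc))
maxᶠ-upper (suc n) f (suc i) = ≤-trans (maxᶠ-upper n (f ∘ suc) i) (m≤n⊔m (f zero) (maxᶠ n (f ∘ suc)))

single : ∀ {n} → Fin n → ℕ → Fin n → ℕ
single i₀ w i with i Fin.≟ i₀
... | yes _ = w
... | no  _ = 0

single-≤ : ∀ {n} (i₀ : Fin n) w i → single i₀ w i ≤ w
single-≤ i₀ w i with i Fin.≟ i₀
... | yes _ = ≤-refl
... | no  _ = z≤n

Σᶠ-single : ∀ n (i₀ : Fin n) w (g : Fin n → ℕ → ℕ) → (∀ i → g i 0 ≡ 0)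
          → Σᶠ n (λ i → g i (single i₀ w i)) ≡ g i₀ w
Σᶠ-single n i₀ w g g0 = trans (Σᶠ-concentrated n i₀ _ off) (cong (g i₀) at)
  where
  at : single i₀ w i₀ ≡ w
  at with i₀ Fin.≟ i₀
  ... | yes _ = refl
  ... | no  i₀≢i₀ = ⊥-elim (i₀≢i₀ refl)
  off : ∀ i → i ≢ i₀ → g i (single i₀ w i) ≡ 0
  off i i≢i₀ with i Fin.≟ i₀
  ... | yes i≡i₀ = ⊥-elim (i≢i₀ i≡i₀)
  ... | no  _    = g0 i

smaller-half : ∀ {a b s} → a + b ≡ s → a ≤ b → 2 * a ≤ s
smaller-half {a} {b} {s} a+b≡s a≤b = begin
  2 * a   ≡⟨ cong (a +_) (+-identityʳ a) ⟩
  a + a   ≤⟨ +-monoʳ-≤ a a≤b ⟩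
  a + b   ≡⟨ a+b≡s ⟩
  s       ∎

%-≡⇒∣∸ : ∀ d .{{_ : NonZero d}} x y → x % d ≡ y % d → d ∣ y ∸ x
%-≡⇒∣∸ d x y x≡y = divides (y / d ∸ x / d) (begin-equality
  y ∸ x                                       ≡⟨ cong₂ _∸_ (m≡m%n+[m/n]*n y d) (m≡m%n+[m/n]*n x d) ⟩
  (y % d + y / d * d) ∸ (x % d + x / d * d)   ≡⟨ cong (λ t → (y % d + y / d * d) ∸ (t + x / d * d)) x≡y ⟩
  (y % d + y / d * d) ∸ (y % d + x / d * d)   ≡⟨ [m+n]∸[m+o]≡n∸o (y % d) _ _ ⟩
  y / d * d ∸ x / d * d                       ≡⟨ *-distribʳ-∸ d (y / d) (x / d) ⟨
  (y / d ∸ x / d) * d                         ∎)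

coprime-cancel-^ : ∀ {d q} a {x} → Coprime d q → d ∣ q ^ a * x → d ∣ x
coprime-cancel-^ {d}         zero    {x} d⊥q d∣ = subst (d ∣_) (+-identityʳ x) d∣
coprime-cancel-^ {d} {q = q} (suc a) {x} d⊥q d∣ =
  coprime-cancel-^ a d⊥q (coprime-divisor d⊥q (subst (d ∣_) (*-assoc q (q ^ a) x) d∣))

-- Every d ≥ 1 coprime to q divides q^m − 1 for some m ≥ 1: two of the
-- d + 1 powers q⁰, …, q^d agree modulo d, say q^a and q^(a+k) with k ≥ 1,
-- and d ∣ q^a (q^k − 1) forces d ∣ q^k − 1.
multiplicative-order : ∀ q d .{{_ : NonZero d}} → Coprime d q → Σ ℕ λ m → 1 ≤ m × d ∣ q ^ m ∸ 1
multiplicative-order q d d⊥q with Finₚ.pigeonhole (n<1+n d) (λ i → Fin.fromℕ< (m%n<n (q ^ toℕ i) d))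
... | i , j , i<j , same = k , 1≤k , coprime-cancel-^ a d⊥q (subst (d ∣_) diff (%-≡⇒∣∸ d _ _ same-rem))
  where
  a : ℕ
  a = toℕ i
  k : ℕ
  k = toℕ j ∸ a
  a+k≡j : a + k ≡ toℕ j
  a+k≡j = m+[n∸m]≡n (<⇒≤ i<j)
  1≤k : 1 ≤ k
  1≤k = +-cancelˡ-≤ a 1 k (subst (_≤ a + k) (+-comm 1 a) (subst (suc a ≤_) (sym a+k≡j) i<j))
  same-rem : q ^ a % d ≡ q ^ toℕ j % d
  same-rem = trans (sym (Finₚ.toℕ-fromℕ< (m%n<n (q ^ a) d)))
                   (trans (cong toℕ same) (Finₚ.toℕ-fromℕ< (m%n<n (q ^ toℕ j) d)))
  diff : q ^ toℕ j ∸ q ^ a ≡ q ^ a * (q ^ k ∸ 1)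
  diff = begin-equality
    q ^ toℕ j ∸ q ^ a           ≡⟨ cong (λ t → q ^ t ∸ q ^ a) a+k≡j ⟨
    q ^ (a + k) ∸ q ^ a         ≡⟨ cong₂ _∸_ (^-distribˡ-+-* q a k) (sym (*-identityʳ (q ^ a))) ⟩
    q ^ a * q ^ k ∸ q ^ a * 1   ≡⟨ *-distribˡ-∸ (q ^ a) (q ^ k) 1 ⟨
    q ^ a * (q ^ k ∸ 1)         ∎

prime-∤⇒coprime : ∀ {p d} → Prime p → ¬ (p ∣ d) → Coprime d p
prime-∤⇒coprime pr p∤d (c∣d , c∣p) with prime⇒irreducible pr c∣p
... | inj₁ c≡1 = c≡1
... | inj₂ c≡p = ⊥-elim (p∤d (subst (_∣ _) c≡p c∣d))

-- Digit sums in base p = r + 2 (the definition of σ only unfolds for such p).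
module DigitSum (r : ℕ) where

  p : ℕ
  p = suc (suc r)

  instance
    p-nonZero : NonZero p
    p-nonZero = _


  regroup-sum : ∀ a₀ a₁ b₀ b₁ q → (a₀ + a₁ * q) + (b₀ + b₁ * q) ≡ a₀ + (b₀ + (a₁ + b₁) * q)
  regroup-sum = solve-∀
  regroup-product : ∀ u₀ u₁ x q → (u₀ + u₁ * q) * x ≡ u₀ * x + (u₁ * x) * q
  regroup-product = solve-∀
  regroup-block : ∀ a₀ a₁ b q Q → a₀ + a₁ * q + b * (q * Q) ≡ a₀ + (a₁ + b * Q) * q
  regroup-block = solve-∀
  interchange : ∀ a b c e → a + (b + (c + e)) ≡ (a + c) + (b + e)
  interchange = solve-∀
  interchange′ : ∀ a b c e → (a + b) + (c + e) ≡ (a + c) + (b + e)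
  interchange′ = solve-∀

  decompose : ∀ x → x ≡ x % p + x / p * p
  decompose x = m≡m%n+[m/n]*n x p

  -- Dropping the last digit at least halves a number: the quotient of a
  -- number ≤ k + 1 is ≤ k. This bounds the recursion depth of σ.
  /p-bound : ∀ k N → N ≤ suc k → N / p ≤ k
  /p-bound k zero    _    = z≤n
  /p-bound k (suc N) N≤k = ≤-pred (≤-trans (m/n<m (suc N) p (s≤s (s≤s z≤n))) N≤k)

  fuel-irrelevant : ∀ k k′ N → N ≤ k → N ≤ k′ → digitSumAux k p N ≡ digitSumAux k′ p N
  fuel-irrelevant zero    zero     zero z≤n z≤n = refl
  fuel-irrelevant zero    (suc k′) zero z≤n _   = fuel-irrelevant zero k′ 0 z≤n z≤n
  fuel-irrelevant (suc k) zero     zero _   z≤n = fuel-irrelevant k zero 0 z≤n z≤n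
  fuel-irrelevant (suc k) (suc k′) N    N≤k N≤k′ =
    cong (N % p +_) (fuel-irrelevant k k′ (N / p) (/p-bound k N N≤k) (/p-bound k′ N N≤k′))

  σ-step : ∀ N → σ p N ≡ N % p + σ p (N / p)
  σ-step zero    = refl
  σ-step (suc N) = cong (suc N % p +_) (fuel-irrelevant N (suc N / p) (suc N / p) (/p-bound N (suc N) ≤-refl) ≤-refl)

  σ-digit : ∀ a b → a < p → σ p (a + b * p) ≡ a + σ p b
  σ-digit a b a<p = trans (σ-step (a + b * p)) (cong₂ _+_ last rest)
    where
    last : (a + b * p) % p ≡ a
    last = trans ([m+kn]%n≡m%n a b p) (m<n⇒m%n≡m a<p)
    rest : σ p ((a + b * p) / p) ≡ σ p b
    rest = cong (σ p) (trans (+-distrib-/-∣ʳ a (divides b refl)) (cong₂ _+_ (m<n⇒m/n≡0 a<p) (m*n/n≡m b p)))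

  σ-*p : ∀ b → σ p (b * p) ≡ σ p b
  σ-*p b = σ-digit 0 b (s≤s z≤n)

  -- Adding one raises the digit sum by at most one (a carry only lowers it).
  σ-suc-bounded : ∀ k x → x ≤ k → σ p (suc x) ≤ suc (σ p x)
  σ-suc-bounded zero    zero z≤n = ≤-refl
  σ-suc-bounded (suc k) x    x≤k = begin
      σ p (suc x)                     ≡⟨ cong (σ p ∘ suc) (decompose x) ⟩
      σ p (suc (x % p) + x / p * p)   ≤⟨ carry (x % p) (x / p) (m%n<n x p) (σ-suc-bounded k (x / p) (/p-bound k x x≤k)) ⟩
      suc (x % p + σ p (x / p))       ≡⟨ cong suc (σ-step x) ⟨
      suc (σ p x)                     ∎
    where
    carry : ∀ a b → a < p → σ p (suc b) ≤ suc (σ p b) → σ p (suc a + b * p) ≤ suc (a + σ p b)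
    carry a b a<p ih with suc a <? p
    ... | yes 1+a<p = ≤-reflexive (σ-digit (suc a) b 1+a<p)
    ... | no  1+a≮p = begin
        σ p (suc a + b * p)   ≡⟨ cong (λ t → σ p (t + b * p)) (≤-antisym a<p (≮⇒≥ 1+a≮p)) ⟩
        σ p (suc b * p)       ≡⟨ σ-*p (suc b) ⟩
        σ p (suc b)           ≤⟨ ih ⟩
        suc (σ p b)           ≤⟨ s≤s (m≤n+m (σ p b) a) ⟩
        suc (a + σ p b)       ∎

  σ-suc : ∀ x → σ p (suc x) ≤ suc (σ p x)
  σ-suc x = σ-suc-bounded x x ≤-refl

  σ-+ˡ : ∀ a y → σ p (a + y) ≤ a + σ p y
  σ-+ˡ zero    y = ≤-refl
  σ-+ˡ (suc a) y = ≤-trans (σ-suc (a + y)) (s≤s (σ-+ˡ a y))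

  -- Subadditivity: split off the last digit a₀ of a, add the last digit of b
  -- without carry, and recurse on the remaining digits.
  σ-subadditive-bounded : ∀ k a b → a ≤ k → σ p (a + b) ≤ σ p a + σ p b
  σ-subadditive-bounded zero    zero b z≤n = ≤-refl
  σ-subadditive-bounded (suc k) a    b a≤k = begin
      σ p (a + b)                       ≡⟨ cong (σ p) (trans (cong₂ _+_ (decompose a) (decompose b)) (regroup-sum a₀ a₁ b₀ b₁ p)) ⟩
      σ p (a₀ + (b₀ + (a₁ + b₁) * p))   ≤⟨ σ-+ˡ a₀ _ ⟩
      a₀ + σ p (b₀ + (a₁ + b₁) * p)     ≡⟨ cong (a₀ +_) (σ-digit b₀ (a₁ + b₁) (m%n<n b p)) ⟩
      a₀ + (b₀ + σ p (a₁ + b₁))         ≤⟨ +-monoʳ-≤ a₀ (+-monoʳ-≤ b₀ (σ-subadditive-bounded k a₁ b₁ (/p-bound k a a≤k))) ⟩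
      a₀ + (b₀ + (σ p a₁ + σ p b₁))     ≡⟨ interchange a₀ b₀ (σ p a₁) (σ p b₁) ⟩
      (a₀ + σ p a₁) + (b₀ + σ p b₁)     ≡⟨ cong₂ _+_ (σ-step a) (σ-step b) ⟨
      σ p a + σ p b                     ∎
    where
    a₀ : ℕ
    a₀ = a % p
    a₁ : ℕ
    a₁ = a / p
    b₀ : ℕ
    b₀ = b % p
    b₁ : ℕ
    b₁ = b / p

  σ-subadditive : ∀ a b → σ p (a + b) ≤ σ p a + σ p b
  σ-subadditive a b = σ-subadditive-bounded a a b ≤-refl

  σ-*ˡ : ∀ k x → σ p (k * x) ≤ k * σ p x
  σ-*ˡ zero    x = z≤n
  σ-*ˡ (suc k) x = ≤-trans (σ-subadditive x (k * x)) (+-monoʳ-≤ (σ p x) (σ-*ˡ k x))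

  -- Submultiplicativity, by expanding u = u₀ + u₁ p.
  σ-submultiplicative-bounded : ∀ k u x → u ≤ k → σ p (u * x) ≤ σ p u * σ p x
  σ-submultiplicative-bounded zero    zero x z≤n = z≤n
  σ-submultiplicative-bounded (suc k) u    x u≤k = begin
      σ p (u * x)                         ≡⟨ cong (σ p) (trans (cong (_* x) (decompose u)) (regroup-product u₀ u₁ x p)) ⟩
      σ p (u₀ * x + (u₁ * x) * p)         ≤⟨ σ-subadditive (u₀ * x) ((u₁ * x) * p) ⟩
      σ p (u₀ * x) + σ p ((u₁ * x) * p)   ≡⟨ cong (σ p (u₀ * x) +_) (σ-*p (u₁ * x)) ⟩
      σ p (u₀ * x) + σ p (u₁ * x)         ≤⟨ +-mono-≤ (σ-*ˡ u₀ x) (σ-submultiplicative-bounded k u₁ x (/p-bound k u u≤k)) ⟩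
      u₀ * σ p x + σ p u₁ * σ p x         ≡⟨ *-distribʳ-+ (σ p x) u₀ (σ p u₁) ⟨
      (u₀ + σ p u₁) * σ p x               ≡⟨ cong (_* σ p x) (σ-step u) ⟨
      σ p u * σ p x                       ∎
    where
    u₀ : ℕ
    u₀ = u % p
    u₁ : ℕ
    u₁ = u / p

  σ-submultiplicative : ∀ u x → σ p (u * x) ≤ σ p u * σ p x
  σ-submultiplicative u x = σ-submultiplicative-bounded u u x ≤-refl

  σ-Σᶠ : ∀ n (f : Fin n → ℕ) → σ p (Σᶠ n f) ≤ Σᶠ n (σ p ∘ f)
  σ-Σᶠ zero    f = z≤n
  σ-Σᶠ (suc n) f = ≤-trans (σ-subadditive (f zero) _) (+-monoʳ-≤ (σ p (f zero)) (σ-Σᶠ n (f ∘ suc)))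

  σ-combination : ∀ n (u d : Fin n → ℕ) → σ p (Σᶠ n (λ i → u i * d i)) ≤ σD p n d * weight p n u
  σ-combination n u d = begin
      σ p (Σᶠ n (λ i → u i * d i))         ≤⟨ σ-Σᶠ n _ ⟩
      Σᶠ n (λ i → σ p (u i * d i))         ≤⟨ Σᶠ-mono n termwise ⟩
      Σᶠ n (λ i → σ p (u i) * σD p n d)    ≡⟨ Σᶠ-*ʳ n (σ p ∘ u) (σD p n d) ⟩
      weight p n u * σD p n d              ≡⟨ *-comm (weight p n u) (σD p n d) ⟩
      σD p n d * weight p n u              ∎
    where
    termwise : ∀ i → σ p (u i * d i) ≤ σ p (u i) * σD p n d
    termwise i = ≤-trans (σ-submultiplicative (u i) (d i))
                         (*-monoʳ-≤ (σ p (u i)) (maxᶠ-upper n (σ p ∘ d) i))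

  -- The numbers p^m − 1, whose m digits all equal p − 1.

  p^m∸1+1 : ∀ m → p ^ m ∸ 1 + 1 ≡ p ^ m
  p^m∸1+1 m = m∸n+n≡m (m^n>0 p m)

  p^m∸1≥1 : ∀ m → 1 ≤ m → 1 ≤ p ^ m ∸ 1
  p^m∸1≥1 m 1≤m = +-cancelʳ-≤ 1 1 (p ^ m ∸ 1)
    (≤-trans (s≤s (s≤s z≤n)) (≤-trans (≤-reflexive (sym (*-identityʳ p)))
      (≤-trans (^-monoʳ-≤ p 1≤m) (≤-reflexive (sym (p^m∸1+1 m))))))

  p^suc∸1 : ∀ m → p ^ suc m ∸ 1 ≡ suc r + (p ^ m ∸ 1) * p
  p^suc∸1 m = trans (cong (λ t → p * t ∸ 1) (sym (p^m∸1+1 m))) (cong (_∸ 1) (expand (p ^ m ∸ 1) r))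
    where
    expand : ∀ X s → suc (suc s) * (X + 1) ≡ suc (suc s + X * suc (suc s))
    expand = solve-∀

  σ-p^m∸1 : ∀ m → σ p (p ^ m ∸ 1) ≡ suc r * m
  σ-p^m∸1 zero    = sym (*-zeroʳ r)
  σ-p^m∸1 (suc m) = begin-equality
      σ p (p ^ suc m ∸ 1)               ≡⟨ cong (σ p) (p^suc∸1 m) ⟩
      σ p (suc r + (p ^ m ∸ 1) * p)     ≡⟨ σ-digit (suc r) (p ^ m ∸ 1) ≤-refl ⟩
      suc r + σ p (p ^ m ∸ 1)           ≡⟨ cong (suc r +_) (σ-p^m∸1 m) ⟩
      suc r + suc r * m                 ≡⟨ *-suc (suc r) m ⟨
      suc r * suc m                     ∎

  σ-block : ∀ m a b → a < p ^ m → σ p (a + b * p ^ m) ≡ σ p a + σ p b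
  σ-block zero    zero    b _ = cong (σ p) (*-identityʳ b)
  σ-block zero    (suc a) b (s≤s ())
  σ-block (suc m) a       b a<p^m = begin-equality
      σ p (a + b * p ^ suc m)               ≡⟨ cong (λ t → σ p (t + b * p ^ suc m)) (decompose a) ⟩
      σ p (a₀ + a₁ * p + b * (p * p ^ m))   ≡⟨ cong (σ p) (regroup-block a₀ a₁ b p (p ^ m)) ⟩
      σ p (a₀ + (a₁ + b * p ^ m) * p)       ≡⟨ σ-digit a₀ (a₁ + b * p ^ m) (m%n<n a p) ⟩
      a₀ + σ p (a₁ + b * p ^ m)             ≡⟨ cong (a₀ +_) (σ-block m a₁ b a₁<p^m) ⟩
      a₀ + (σ p a₁ + σ p b)                 ≡⟨ +-assoc a₀ (σ p a₁) (σ p b) ⟨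
      a₀ + σ p a₁ + σ p b                   ≡⟨ cong (_+ σ p b) (σ-step a) ⟨
      σ p a + σ p b                         ∎
    where
    a₀ : ℕ
    a₀ = a % p
    a₁ : ℕ
    a₁ = a / p
    a₁<p^m : a₁ < p ^ m
    a₁<p^m = m<n*o⇒m/o<n (subst (a <_) (*-comm p (p ^ m)) a<p^m)

  -- For x < p^m the digits of x and of p^m − 1 − x add up to p − 1 in each
  -- of the m positions.
  complement-digits : ∀ m x₀ x₁ → x₀ ≤ suc r → x₁ ≤ p ^ m ∸ 1
                    → p ^ suc m ∸ 1 ∸ (x₀ + x₁ * p) ≡ (suc r ∸ x₀) + (p ^ m ∸ 1 ∸ x₁) * p
  complement-digits m x₀ x₁ x₀≤ x₁≤ = trans (cong (_∸ x) (sym y+x≡)) (m+n∸n≡m y x)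
    where
    x : ℕ
    x = x₀ + x₁ * p
    y : ℕ
    y = (suc r ∸ x₀) + (p ^ m ∸ 1 ∸ x₁) * p
    y+x≡ : y + x ≡ p ^ suc m ∸ 1
    y+x≡ = begin-equality
      y + x                                                  ≡⟨ regroup-sum (suc r ∸ x₀) (p ^ m ∸ 1 ∸ x₁) x₀ x₁ p ⟩
      (suc r ∸ x₀) + (x₀ + (p ^ m ∸ 1 ∸ x₁ + x₁) * p)        ≡⟨ +-assoc (suc r ∸ x₀) x₀ _ ⟨
      (suc r ∸ x₀) + x₀ + (p ^ m ∸ 1 ∸ x₁ + x₁) * p          ≡⟨ cong₂ (λ s t → s + t * p) (m∸n+n≡m x₀≤) (m∸n+n≡m x₁≤) ⟩
      suc r + (p ^ m ∸ 1) * p                                ≡⟨ p^suc∸1 m ⟨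
      p ^ suc m ∸ 1                                          ∎

  σ-complement : ∀ m x → x < p ^ m → σ p x + σ p (p ^ m ∸ 1 ∸ x) ≡ suc r * m
  σ-complement zero    zero    _ = sym (*-zeroʳ r)
  σ-complement zero    (suc x) (s≤s ())
  σ-complement (suc m) x       x<p^m = begin-equality
      σ p x + σ p (p ^ suc m ∸ 1 ∸ x)
        ≡⟨ cong₂ (λ s t → σ p s + σ p (p ^ suc m ∸ 1 ∸ t)) (decompose x) (decompose x) ⟩
      σ p (x₀ + x₁ * p) + σ p (p ^ suc m ∸ 1 ∸ (x₀ + x₁ * p))
        ≡⟨ cong₂ _+_ (σ-digit x₀ x₁ (m%n<n x p)) (cong (σ p) (complement-digits m x₀ x₁ x₀≤ x₁≤)) ⟩
      (x₀ + σ p x₁) + σ p ((suc r ∸ x₀) + (p ^ m ∸ 1 ∸ x₁) * p)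
        ≡⟨ cong ((x₀ + σ p x₁) +_) (σ-digit (suc r ∸ x₀) (p ^ m ∸ 1 ∸ x₁) (s≤s (m∸n≤m (suc r) x₀))) ⟩
      (x₀ + σ p x₁) + ((suc r ∸ x₀) + σ p (p ^ m ∸ 1 ∸ x₁))
        ≡⟨ interchange′ x₀ (σ p x₁) (suc r ∸ x₀) _ ⟩
      (x₀ + (suc r ∸ x₀)) + (σ p x₁ + σ p (p ^ m ∸ 1 ∸ x₁))
        ≡⟨ cong₂ _+_ (m+[n∸m]≡n x₀≤) (σ-complement m x₁ x₁<p^m) ⟩
      suc r + suc r * m
        ≡⟨ *-suc (suc r) m ⟨
      suc r * suc m ∎
    where
    x₀ : ℕ
    x₀ = x % p
    x₁ : ℕ
    x₁ = x / p
    x₀≤ : x₀ ≤ suc r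
    x₀≤ = ≤-pred (m%n<n x p)
    x₁<p^m : x₁ < p ^ m
    x₁<p^m = m<n*o⇒m/o<n (subst (x <_) (*-comm p (p ^ m)) x<p^m)
    x₁≤ : x₁ ≤ p ^ m ∸ 1
    x₁≤ = +-cancelʳ-≤ 1 x₁ (p ^ m ∸ 1) (subst₂ _≤_ (+-comm 1 x₁) (sym (p^m∸1+1 m)) x₁<p^m)

  module Multiples (m : ℕ) where

    instance
      p^m-nonZero : NonZero (p ^ m)
      p^m-nonZero = m^n≢0 p m

    multiple-below-p^m : ∀ S → 1 ≤ m → 0 < S → S < p ^ m → (p ^ m ∸ 1) ∣ S → S ≡ p ^ m ∸ 1
    multiple-below-p^m S 1≤m 0<S S<p^m (divides zero          S≡0)  = ⊥-elim (<⇒≢ 0<S (sym S≡0))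
    multiple-below-p^m S 1≤m 0<S S<p^m (divides (suc zero)    S≡X)  = trans S≡X (+-identityʳ _)
    multiple-below-p^m S 1≤m 0<S S<p^m (divides (suc (suc k)) S≡kX) = ⊥-elim (<⇒≱ S<p^m (begin
        p ^ m                         ≡⟨ p^m∸1+1 m ⟨
        X + 1                         ≤⟨ +-monoʳ-≤ X (≤-trans (p^m∸1≥1 m 1≤m) (m≤m+n X (k * X))) ⟩
        X + (X + k * X)               ≡⟨ S≡kX ⟨
        S                             ∎))
      where
      X : ℕ
      X = p ^ m ∸ 1

    fold : ℕ → ℕ
    fold S = S % p ^ m + S / p ^ m

    fold-σ : ∀ S → σ p (fold S) ≤ σ p S
    fold-σ S = begin
        σ p (S % p ^ m + S / p ^ m)               ≤⟨ σ-subadditive (S % p ^ m) (S / p ^ m) ⟩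
        σ p (S % p ^ m) + σ p (S / p ^ m)         ≡⟨ σ-block m (S % p ^ m) (S / p ^ m) (m%n<n S (p ^ m)) ⟨
        σ p (S % p ^ m + S / p ^ m * p ^ m)       ≡⟨ cong (σ p) (m≡m%n+[m/n]*n S (p ^ m)) ⟨
        σ p S                                     ∎

    -- Since p^m ≡ 1 modulo p^m − 1, folding preserves divisibility by it.
    fold-∣ : ∀ S → (p ^ m ∸ 1) ∣ S → (p ^ m ∸ 1) ∣ fold S
    fold-∣ S X∣S = ∣m+n∣m⇒∣n (subst ((p ^ m ∸ 1) ∣_) S≡ X∣S) (divides (S / p ^ m) refl)
      where
      move : ∀ s₀ s₁ X → s₀ + s₁ * (X + 1) ≡ s₁ * X + (s₀ + s₁)
      move = solve-∀
      S≡ : S ≡ S / p ^ m * (p ^ m ∸ 1) + fold S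
      S≡ = trans (m≡m%n+[m/n]*n S (p ^ m))
                 (trans (cong (λ t → S % p ^ m + S / p ^ m * t) (sym (p^m∸1+1 m))) (move (S % p ^ m) (S / p ^ m) (p ^ m ∸ 1)))

    fold-< : ∀ S → 1 ≤ m → p ^ m ≤ S → fold S < S
    fold-< S 1≤m p^m≤S = begin-strict
        S % p ^ m + S / p ^ m           <⟨ +-monoʳ-< (S % p ^ m) (m<m*n (S / p ^ m) (p ^ m) {{>-nonZero q≥1}} 1<p^m) ⟩
        S % p ^ m + S / p ^ m * p ^ m   ≡⟨ m≡m%n+[m/n]*n S (p ^ m) ⟨
        S                               ∎
      where
      q≥1 : 1 ≤ S / p ^ m
      q≥1 = m≥n⇒m/n>0 p^m≤S
      1<p^m : 1 < p ^ m
      1<p^m = subst (1 <_) (p^m∸1+1 m) (+-monoˡ-≤ 1 (p^m∸1≥1 m 1≤m))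

    fold-pos : ∀ S → p ^ m ≤ S → 0 < fold S
    fold-pos S p^m≤S = ≤-trans (m≥n⇒m/n>0 p^m≤S) (m≤n+m (S / p ^ m) (S % p ^ m))

    σ-multiple-bounded : ∀ k S → S < k → 1 ≤ m → 0 < S → (p ^ m ∸ 1) ∣ S → suc r * m ≤ σ p S
    σ-multiple-bounded (suc k) S S<k 1≤m 0<S X∣S with S <? p ^ m
    ... | yes S<p^m = ≤-reflexive (trans (sym (σ-p^m∸1 m)) (cong (σ p) (sym (multiple-below-p^m S 1≤m 0<S S<p^m X∣S))))
    ... | no  S≮p^m = ≤-trans
            (σ-multiple-bounded k (fold S) (<-≤-trans (fold-< S 1≤m p^m≤S) (≤-pred S<k)) 1≤m (fold-pos S p^m≤S) (fold-∣ S X∣S))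
            (fold-σ S)
      where
      p^m≤S : p ^ m ≤ S
      p^m≤S = ≮⇒≥ S≮p^m

  σ-multiple : ∀ m S → 1 ≤ m → 0 < S → (p ^ m ∸ 1) ∣ S → suc r * m ≤ σ p S
  σ-multiple m S = Multiples.σ-multiple-bounded m (suc S) S ≤-refl

  lower-bound : ∀ n (d : Fin n → ℕ) m (u : Fin n → ℕ) → 1 ≤ m → InE p n d m u → suc r * m ≤ σD p n d * weight p n u
  lower-bound n d m u 1≤m U∈E =
    ≤-trans (σ-multiple m _ 1≤m (InE.positive U∈E) (InE.divisible U∈E)) (σ-combination n u d)

  -- If δ ≥ 2 divides p^m − 1 (m ≥ 1), one of c = (p^m − 1)/δ and its
  -- complement p^m − 1 − c = c(δ − 1) has digit sum at most (p − 1) m / 2,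
  -- and its product with δ is a positive multiple of p^m − 1.
  cheap-multiplier : ∀ m δ → 1 ≤ m → 2 ≤ δ → δ ∣ p ^ m ∸ 1
                   → Σ ℕ λ w → w < p ^ m × (p ^ m ∸ 1) ∣ w * δ × 0 < w * δ × 2 * σ p w ≤ suc r * m
  cheap-multiplier m δ 1≤m 2≤δ (divides c X≡cδ) = choose (_ ≤? _)
    where
    X : ℕ
    X = p ^ m ∸ 1
    c′ : ℕ
    c′ = X ∸ c
    X<p^m : X < p ^ m
    X<p^m = subst (X <_) (p^m∸1+1 m) (subst (_≤ X + 1) (+-comm X 1) ≤-refl)
    1≤c : 1 ≤ c
    1≤c = n≢0⇒n>0 (λ c≡0 → <⇒≢ (p^m∸1≥1 m 1≤m) (sym (trans X≡cδ (cong (_* δ) c≡0))))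
    c<p^m : c < p ^ m
    c<p^m = ≤-<-trans (subst (c ≤_) (sym X≡cδ) (m≤m*n c δ {{>-nonZero (≤-trans (s≤s z≤n) 2≤δ)}})) X<p^m
    c′<p^m : c′ < p ^ m
    c′<p^m = ≤-<-trans (m∸n≤m X c) X<p^m
    c′≡ : c′ ≡ c * (δ ∸ 1)
    c′≡ = trans (cong₂ _∸_ X≡cδ (sym (*-identityʳ c))) (sym (*-distribˡ-∸ c δ 1))
    1≤c′ : 1 ≤ c′
    1≤c′ = subst (1 ≤_) (sym c′≡) (*-mono-≤ 1≤c (∸-monoˡ-≤ 1 2≤δ))
    total : σ p c + σ p c′ ≡ suc r * m
    total = σ-complement m c c<p^m
    c-multiple : X ∣ c * δ
    c-multiple = divides 1 (trans (sym X≡cδ) (sym (*-identityˡ X)))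
    c′-multiple : X ∣ c′ * δ
    c′-multiple = divides (δ ∸ 1) (begin-equality
      c′ * δ              ≡⟨ cong (_* δ) c′≡ ⟩
      c * (δ ∸ 1) * δ     ≡⟨ reorder c (δ ∸ 1) δ ⟩
      (δ ∸ 1) * (c * δ)   ≡⟨ cong ((δ ∸ 1) *_) X≡cδ ⟨
      (δ ∸ 1) * X         ∎)
      where
      reorder : ∀ a b e → a * b * e ≡ b * (a * e)
      reorder = solve-∀
    multiple-positive : ∀ w → 1 ≤ w → 0 < w * δ
    multiple-positive w 1≤w = *-mono-≤ 1≤w (≤-trans (s≤s z≤n) 2≤δ)
    choose : Dec (σ p c ≤ σ p c′)
           → Σ ℕ λ w → w < p ^ m × (p ^ m ∸ 1) ∣ w * δ × 0 < w * δ × 2 * σ p w ≤ suc r * m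
    choose (yes c≤c′) = c  , c<p^m  , c-multiple  , multiple-positive c 1≤c  , smaller-half total c≤c′
    choose (no  c≰c′) = c′ , c′<p^m , c′-multiple , multiple-positive c′ 1≤c′ ,
                        smaller-half (trans (+-comm (σ p c′) (σ p c)) total) (<⇒≤ (≰⇒> c≰c′))

  upper-witness : Prime p → ∀ n (d : Fin n → ℕ) (i₀ : Fin n) → 2 ≤ d i₀ → ¬ (p ∣ d i₀)
                → Σ ℕ λ m → 1 ≤ m × Σ (Fin n → ℕ) λ u → InE p n d m u × 2 * weight p n u ≤ suc r * m
  upper-witness pr n d i₀ 2≤δ p∤δ
    with multiplicative-order p (d i₀) {{>-nonZero (≤-trans (s≤s z≤n) 2≤δ)}} (prime-∤⇒coprime pr p∤δ)
  ... | m , 1≤m , δ∣X with cheap-multiplier m (d i₀) 1≤m 2≤δ δ∣X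
  ... | w , w<p^m , X∣wδ , 0<wδ , small = m , 1≤m , u , U∈E , subst (λ t → 2 * t ≤ suc r * m) (sym weight≡) small
    where
    u : Fin n → ℕ
    u = single i₀ w
    combination≡ : Σᶠ n (λ i → u i * d i) ≡ w * d i₀
    combination≡ = Σᶠ-single n i₀ w (λ i x → x * d i) (λ _ → refl)
    weight≡ : weight p n u ≡ σ p w
    weight≡ = Σᶠ-single n i₀ w (λ _ → σ p) (λ _ → refl)
    U∈E : InE p n d m u
    U∈E = record
      { bounded   = λ i → ≤-<-trans (single-≤ i₀ w i) w<p^m
      ; divisible = subst (_ ∣_) (sym combination≡) X∣wδ
      ; positive  = subst (0 <_) (sym combination≡) 0<wδ
      }

mainTheorem9 : (p : ℕ) → Prime p → (n : ℕ) → (d : Fin n → ℕ) → Injective _≡_ _≡_ d → 1 ≤ n → (∀ i → 1 ≤ d i) → (∀ i → ¬ (p ∣ d i)) → ¬ (∀ i → d i ≡ 1)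
    → ((m : ℕ) → 1 ≤ m → (u : Fin n → ℕ) → InE p n d m u → (p ∸ 1) * m ≤ σD p n d * weight p n u)
      × Σ ℕ (λ m → 1 ≤ m × Σ (Fin n → ℕ) (λ u → InE p n d m u × 2 * weight p n u ≤ (p ∸ 1) * m))
mainTheorem9 0 ()
mainTheorem9 1 ()
mainTheorem9 (suc (suc r)) pr n d _ _ d≥1 p∤d not-all-one
  with Finₚ.¬∀⟶∃¬ n (λ i → d i ≡ 1) (λ i → d i ≟ 1) not-all-one
... | i₀ , dᵢ₀≢1 =
    (λ m 1≤m u → lower-bound n d m u 1≤m)
  , upper-witness pr n d i₀ (≤∧≢⇒< (d≥1 i₀) (≢-sym dᵢ₀≢1)) (p∤d i₀)
  where open DigitSum r
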